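{- Let $T\in\mathcal{T}_3$ be a labeled tree over an alphabet containing the letters $0$ and $1$. Then $\mathcal{L}(T)$ cannot contain both a word of $0^+1^+0^+$ and a word of $1^+0^+1^+$.
   Context: A tree is a finite undirected, acyclic, connected graph with edges labeled by letters of a finite alphabet $\Sigma$. For nodes $x,y$, $\pi(x,y)$ is the word of labels along the unique simple path from $x$ to $y$, and $\mathcal{L}(T)=\{\pi(x,y)\}$ over all pairs of nodes. For a word $w$, $|\Delta(w)|$ is the number of maximal blocks of equal consecutive letters of $w$. $\mathcal{T}_3$ is the set of labeled trees $T$ with $|\Delta(f)|\le 3$ for all $f\in\mathcal{L}(T)$. $a^+$ denotes the set of nonempty words consisting only of the letter $a$. -}

module Defs where

open import Data.Nat using (ℕ; zero; suc; _+_; _≤_; _<_)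
open import Data.Fin using (Fin; zero; suc; _≟_)
open import Data.List using (List; []; _∷_; _++_; replicate; length)
open import Data.List.Relation.Unary.Unique.Propositional using (Unique)
open import Data.Product using (Σ; ∃; _×_; _,_)
open import Relation.Binary.PropositionalEquality using (_≡_)
open import Relation.Nullary using (¬_; yes; no)

-- An undirected multigraph with n nodes (Fin n) and m edges (Fin m),
-- each edge labelled by a letter of the finite alphabet Fin k.
record LGraph (k : ℕ) : Set where
  field
    n   : ℕ
    m   : ℕ
    src : Fin m → Fin n
    lab : Fin m → Fin k
    tgt : Fin m → Fin n

module _ {k : ℕ} (G : LGraph k) where
  open LGraph G

  data Step (x y : Fin n) : Set where
    fwd : (e : Fin m) → src e ≡ x → tgt e ≡ y → Step x y
    bwd : (e : Fin m) → tgt e ≡ x → src e ≡ y → Step x y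

  stepEdge : ∀ {x y} → Step x y → Fin m
  stepEdge (fwd e _ _) = e
  stepEdge (bwd e _ _) = e

  data Walk : Fin n → Fin n → Set where
    []  : ∀ {x} → Walk x x
    _∷_ : ∀ {x y z} → Step x y → Walk y z → Walk x z

  word : ∀ {x y} → Walk x y → List (Fin k)
  word []       = []
  word (s ∷ p)  = lab (stepEdge s) ∷ word p

  edgesOf : ∀ {x y} → Walk x y → List (Fin m)
  edgesOf []      = []
  edgesOf (s ∷ p) = stepEdge s ∷ edgesOf p

  innerVerts : ∀ {x y} → Walk x y → List (Fin n)
  innerVerts []             = []
  innerVerts {x} (s ∷ p)    = x ∷ innerVerts p

  verts : ∀ {x y} → Walk x y → List (Fin n)
  verts {x} {y} p = innerVerts p ++ (y ∷ [])

  SimplePath : ∀ {x y} → Walk x y → Set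
  SimplePath p = Unique (verts p)

  Cycle : ∀ {x} → Walk x x → Set
  Cycle p = (1 ≤ length (edgesOf p)) × Unique (edgesOf p) × Unique (innerVerts p)

  Connected : Set
  Connected = ∀ (x y : Fin n) → Walk x y

  Acyclic : Set
  Acyclic = ∀ (x : Fin n) (p : Walk x x) → ¬ Cycle p

  InL : List (Fin k) → Set
  InL w = ∃ λ (x : Fin n) → ∃ λ (y : Fin n) → Σ (Walk x y) λ p → SimplePath p × word p ≡ w

record IsTree {k : ℕ} (G : LGraph k) : Set where
  field
    nonempty  : 1 ≤ LGraph.n G
    connected : Connected G
    acyclic   : Acyclic G

-- |Δ(w)|: number of maximal blocks of equal consecutive letters
-- blocksFrom a w: number of blocks of (a ∷ w)
blocksFrom : ∀ {k} → Fin k → List (Fin k) → ℕ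
blocksFrom a []      = 1
blocksFrom a (b ∷ w) with a ≟ b
... | yes _ = blocksFrom b w
... | no  _ = suc (blocksFrom b w)

blocks : ∀ {k} → List (Fin k) → ℕ
blocks []      = 0
blocks (a ∷ w) = blocksFrom a w

InT3 : ∀ {k} (G : LGraph k) → Set
InT3 G = IsTree G × (∀ w → InL G w → blocks w ≤ 3)

InABA : ∀ {k} → Fin k → Fin k → List (Fin k) → Set
InABA a b w = ∃ λ i → ∃ λ j → ∃ λ l →
  (1 ≤ i) × (1 ≤ j) × (1 ≤ l) × (w ≡ replicate i a ++ replicate j b ++ replicate l a)

module Submission where

-- Non-backtracking walks in a tree are simple paths, so their words lie in L(T).
-- A path reading 0⁺1⁺0⁺ has a vertex v where it switches from 1 to 0 (after a 0),
-- and a path reading 1⁺0⁺1⁺ a vertex s where it switches from 1 to 0 (before a 1).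
-- Join v to s by a non-backtracking walk R.  At each end, the two halves of the
-- path through that vertex leave it by edges with different labels, so one of
-- them leaves by an edge other than the one R uses; continuing R by it keeps the
-- walk non-backtracking, and in every case its word contains 0101 as a
-- subsequence, hence has at least four blocks.

open import Defs
open import Data.Nat using (ℕ; zero; suc; _≤_; z≤n; s≤s)
open import Data.Nat.Properties using (≤-refl; ≤-trans; n≤1+n; n≮n)
open import Data.Fin using (Fin; zero; suc; _≟_)
open import Data.List using (List; []; _∷_; _++_; _ʳ++_; reverse; replicate; head)
open import Data.List.Properties using (++-assoc; ++-ʳ++; ∷-injectiveˡ; ∷-injectiveʳ)
open import Data.List.Relation.Unary.Linked as Linked using (Linked; []; [-]; _∷_; _∷′_)
open import Data.List.Relation.Unary.All using ([]; _∷_)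
import Data.List.Relation.Unary.All as All
open import Data.List.Relation.Unary.All.Properties using (¬Any⇒All¬; All¬⇒¬Any; ++⁻ˡ; ++⁻ʳ)
open import Data.List.Relation.Unary.Any using (here; there)
open import Data.List.Relation.Unary.Any.Properties using (reverse⁺; ++⁺ʳ)
open import Data.List.Relation.Unary.AllPairs using ([]; _∷_)
open import Data.List.Relation.Unary.Unique.Propositional using (Unique)
open import Data.List.Membership.Propositional using (_∈_; _∉_)
open import Data.List.Relation.Binary.Sublist.Propositional using (_⊆_; []; _∷_; _∷ʳ_; minimum; from∈)
open import Data.List.Relation.Binary.Sublist.Propositional.Properties using (ʳ++⁺)
open import Data.Maybe using (just)
open import Data.Maybe.Relation.Binary.Connected as Connectedᴹ using (just; just-nothing; nothing-just; nothing)
  renaming (Connected to Connectedᴹ)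
open import Data.Product using (Σ; ∃; ∃-syntax; _×_; _,_)
open import Data.Sum using (_⊎_; inj₁; inj₂)
open import Function using (flip; id)
open import Relation.Binary.PropositionalEquality
  using (_≡_; _≢_; refl; sym; trans; cong; cong₂; subst; ≢-sym)
open import Relation.Nullary using (¬_; yes; no)

module _ {k : ℕ} where

  blocksFrom-∷-≥ : ∀ (a b : Fin k) w → blocksFrom b w ≤ blocksFrom a (b ∷ w)
  blocksFrom-∷-≥ a b w with a ≟ b
  ... | yes _ = ≤-refl
  ... | no  _ = n≤1+n _

  blocksFrom-∷-≤ : ∀ (a b : Fin k) w → blocksFrom a (b ∷ w) ≤ suc (blocksFrom b w)
  blocksFrom-∷-≤ a b w with a ≟ b
  ... | yes _ = n≤1+n _
  ... | no  _ = ≤-refl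

  blocksFrom-≤-suc : ∀ (a c : Fin k) w → blocksFrom a w ≤ suc (blocksFrom c w)
  blocksFrom-≤-suc a c []      = s≤s z≤n
  blocksFrom-≤-suc a c (d ∷ w) = ≤-trans (blocksFrom-∷-≤ a d w) (s≤s (blocksFrom-∷-≥ c d w))

  blocksFrom-insert : ∀ (a y : Fin k) w → blocksFrom a w ≤ blocksFrom a (y ∷ w)
  blocksFrom-insert a y w with a ≟ y
  ... | yes refl = ≤-refl
  ... | no  _    = blocksFrom-≤-suc a y w

  blocksFrom-mono : ∀ (a : Fin k) {xs ys} → xs ⊆ ys → blocksFrom a xs ≤ blocksFrom a ys
  blocksFrom-mono a []                = ≤-refl
  blocksFrom-mono a (y ∷ʳ σ)          = ≤-trans (blocksFrom-mono a σ) (blocksFrom-insert a y _)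
  blocksFrom-mono a (_∷_ {x} refl σ) with a ≟ x
  ... | yes _ = blocksFrom-mono x σ
  ... | no  _ = s≤s (blocksFrom-mono x σ)

  blocks-≤-blocksFrom : ∀ (a : Fin k) w → blocks w ≤ blocksFrom a w
  blocks-≤-blocksFrom a []      = z≤n
  blocks-≤-blocksFrom a (b ∷ w) = blocksFrom-∷-≥ a b w

  blocks-mono : ∀ {xs ys : List (Fin k)} → xs ⊆ ys → blocks xs ≤ blocks ys
  blocks-mono {[]}    _                    = z≤n
  blocks-mono {_ ∷ _} {_ ∷ ys} (y ∷ʳ σ)   = ≤-trans (blocks-mono σ) (blocks-≤-blocksFrom y ys)
  blocks-mono {_ ∷ _}          (refl ∷ σ) = blocksFrom-mono _ σ

module _ {A : Set} where

  Linked-ʳ++⁺ : ∀ {R : A → A → Set} {xs ys} → Linked (flip R) xs →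
                Connectedᴹ R (head xs) (head ys) → Linked R ys → Linked R (xs ʳ++ ys)
  Linked-ʳ++⁺ {xs = []}     _  _ l = l
  Linked-ʳ++⁺ {xs = x ∷ xs} lx c l =
    Linked-ʳ++⁺ (Linked.tail lx) (Connectedᴹ.sym id (Linked.head′ lx)) (c ∷′ l)

  Linked-ʳ++⁻ : ∀ {R : A → A → Set} xs {ys} → Linked R (xs ʳ++ ys) →
                Linked (flip R) xs × Connectedᴹ R (head xs) (head ys) × Linked R ys
  Linked-ʳ++⁻ [] {[]}    l = [] , nothing , l
  Linked-ʳ++⁻ [] {_ ∷ _} l = [] , nothing-just , l
  Linked-ʳ++⁻ (x ∷ xs) l with Linked-ʳ++⁻ xs l
  ... | lx , c , l′ = Connectedᴹ.sym id c ∷′ lx , Linked.head′ l′ , Linked.tail l′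

  Unique-∷ʳ⇒∷ : ∀ {x : A} xs → Unique (xs ++ x ∷ []) → Unique (x ∷ xs)
  Unique-∷ʳ⇒∷ []       u        = u
  Unique-∷ʳ⇒∷ (y ∷ xs) (y∉ ∷ u) with Unique-∷ʳ⇒∷ xs u
  ... | x∉ ∷ u′ = (≢-sym y≢x ∷ x∉) ∷ ++⁻ˡ xs y∉ ∷ u′
    where y≢x = All.head (++⁻ʳ xs y∉)

  ⊆-∷⁻ : ∀ {c : A} {S w} → head S ≢ just c → S ⊆ c ∷ w → S ⊆ w
  ⊆-∷⁻ {S = []}    _  _          = minimum _
  ⊆-∷⁻ {S = _ ∷ _} _  (_ ∷ʳ σ)   = σ
  ⊆-∷⁻ {S = _ ∷ _} ne (refl ∷ _) with () ← ne refl

  replicate-suc-++ : ∀ n (x : A) ys → replicate (suc n) x ++ ys ≡ replicate n x ++ x ∷ ys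
  replicate-suc-++ zero    x ys = refl
  replicate-suc-++ (suc n) x ys = cong (x ∷_) (replicate-suc-++ n x ys)

module _ {k : ℕ} {a b : Fin k} where

  InABA-last-descent : ∀ {w} → InABA a b w → ∃[ u ] ∃[ v ] w ≡ u ++ b ∷ a ∷ v × a ∈ u
  InABA-last-descent (suc i , suc j , suc l , _ , _ , _ , refl) =
    replicate (suc i) a ++ replicate j b , replicate l a ,
    trans (cong (replicate (suc i) a ++_) (replicate-suc-++ j b _))
          (sym (++-assoc (replicate (suc i) a) _ _)) ,
    here refl

  InABA-first-descent : ∀ {w} → InABA b a w → ∃[ u ] ∃[ v ] w ≡ u ++ b ∷ a ∷ v × b ∈ v
  InABA-first-descent (suc i , suc j , suc l , _ , _ , _ , refl) =
    replicate i b , replicate j a ++ replicate (suc l) b ,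
    replicate-suc-++ i b _ ,
    ++⁺ʳ (replicate j a) (here refl)

module Walks {k : ℕ} (G : LGraph k) where
  open LGraph G

  private
    variable
      u v x y z : Fin n

  flipStep : Step G x y → Step G y x
  flipStep (fwd e p q) = bwd e q p
  flipStep (bwd e p q) = fwd e q p

  flipStep-involutive : (s : Step G x y) → flipStep (flipStep s) ≡ s
  flipStep-involutive (fwd e p q) = refl
  flipStep-involutive (bwd e p q) = refl

  stepEdge-flipStep : (s : Step G x y) → stepEdge G (flipStep s) ≡ stepEdge G s
  stepEdge-flipStep (fwd e p q) = refl
  stepEdge-flipStep (bwd e p q) = refl

  infixr 5 _ʳ++ʷ_
  _ʳ++ʷ_ : Walk G u x → Walk G u y → Walk G x y
  []      ʳ++ʷ q = q
  (s ∷ p) ʳ++ʷ q = p ʳ++ʷ (flipStep s ∷ q)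

  edgesOf-ʳ++ʷ : (p : Walk G u x) (q : Walk G u y) → edgesOf G (p ʳ++ʷ q) ≡ edgesOf G p ʳ++ edgesOf G q
  edgesOf-ʳ++ʷ []      q = refl
  edgesOf-ʳ++ʷ (s ∷ p) q =
    trans (edgesOf-ʳ++ʷ p (flipStep s ∷ q))
          (cong (λ e → edgesOf G p ʳ++ e ∷ edgesOf G q) (stepEdge-flipStep s))

  word-ʳ++ʷ : (p : Walk G u x) (q : Walk G u y) → word G (p ʳ++ʷ q) ≡ word G p ʳ++ word G q
  word-ʳ++ʷ []      q = refl
  word-ʳ++ʷ (s ∷ p) q =
    trans (word-ʳ++ʷ p (flipStep s ∷ q))
          (cong (λ e → word G p ʳ++ lab e ∷ word G q) (stepEdge-flipStep s))

  splitʷ : (r : Walk G x v) (p : Walk G x y) (w₁ : List (Fin k)) {w₂ : List (Fin k)} →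
           word G p ≡ w₁ ++ w₂ →
           ∃[ u ] Σ (Walk G u v) λ p₁ → Σ (Walk G u y) λ p₂ →
             r ʳ++ʷ p ≡ p₁ ʳ++ʷ p₂ × word G p₁ ≡ w₁ ʳ++ word G r × word G p₂ ≡ w₂
  splitʷ r p       []       eq = _ , r , p , refl , refl , eq
  splitʷ r (s ∷ p) (c ∷ w₁) eq with splitʷ (flipStep s ∷ r) p w₁ (∷-injectiveʳ eq)
  ... | _ , p₁ , p₂ , eqʷ , eq₁ , eq₂ =
    _ , p₁ , p₂ ,
    trans (cong (λ t → r ʳ++ʷ t ∷ p) (sym (flipStep-involutive s))) eqʷ ,
    trans eq₁ (cong (λ c′ → w₁ ʳ++ c′ ∷ word G r)
                    (trans (cong lab (stepEdge-flipStep s)) (∷-injectiveˡ eq))) ,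
    eq₂

  Endpoint : Fin n → Fin m → Set
  Endpoint v e = src e ≡ v ⊎ tgt e ≡ v

  stepEdge-source : (s : Step G x y) → Endpoint x (stepEdge G s)
  stepEdge-source (fwd e p q) = inj₁ p
  stepEdge-source (bwd e p q) = inj₂ p

  stepEdge-target : (s : Step G x y) → Endpoint y (stepEdge G s)
  stepEdge-target (fwd e p q) = inj₂ q
  stepEdge-target (bwd e p q) = inj₁ q

  stepEdge-endpoints : (s : Step G x y) → Endpoint v (stepEdge G s) → v ≡ x ⊎ v ≡ y
  stepEdge-endpoints (fwd e p q) (inj₁ p′) = inj₁ (trans (sym p′) p)
  stepEdge-endpoints (fwd e p q) (inj₂ q′) = inj₂ (trans (sym q′) q)
  stepEdge-endpoints (bwd e p q) (inj₁ p′) = inj₂ (trans (sym p′) q)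
  stepEdge-endpoints (bwd e p q) (inj₂ q′) = inj₁ (trans (sym q′) p)

  sameEdge-return : (s : Step G x y) (t : Step G y z) → stepEdge G s ≡ stepEdge G t → z ≡ x
  sameEdge-return s t eq with stepEdge-endpoints s (subst (Endpoint _) (sym eq) (stepEdge-target t))
  ... | inj₁ z≡x = z≡x
  ... | inj₂ refl with stepEdge-endpoints t (subst (Endpoint _) eq (stepEdge-source s))
  ...   | inj₁ x≡y = sym x≡y
  ...   | inj₂ x≡z = sym x≡z

  head∈verts : (p : Walk G x y) → x ∈ verts G p
  head∈verts []      = here refl
  head∈verts (_ ∷ _) = here refl

  endpoint∈verts : ∀ {e} (p : Walk G x y) → e ∈ edgesOf G p → Endpoint v e → v ∈ verts G p
  endpoint∈verts (s ∷ p) (here refl) ep with stepEdge-endpoints s ep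
  ... | inj₁ refl = here refl
  ... | inj₂ refl = there (head∈verts p)
  endpoint∈verts (s ∷ p) (there e∈) ep = there (endpoint∈verts p e∈ ep)

  NonBacktracking : Walk G x y → Set
  NonBacktracking p = Linked _≢_ (edgesOf G p)

  -- Holds vacuously when p or q is empty.
  Diverge : Walk G u x → Walk G u y → Set
  Diverge p q = Connectedᴹ _≢_ (head (edgesOf G p)) (head (edgesOf G q))

  Diverge-sym : {p : Walk G u x} {q : Walk G u y} → Diverge p q → Diverge q p
  Diverge-sym = Connectedᴹ.sym ≢-sym

  ʳ++ʷ-nonBacktracking : (p : Walk G u x) (q : Walk G u y) →
    NonBacktracking p → NonBacktracking q → Diverge p q → NonBacktracking (p ʳ++ʷ q)
  ʳ++ʷ-nonBacktracking p q nbp nbq d =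
    subst (Linked _≢_) (sym (edgesOf-ʳ++ʷ p q)) (Linked-ʳ++⁺ (Linked.map ≢-sym nbp) d nbq)

  ʳ++ʷ-nonBacktracking⁻ : (p : Walk G u x) (q : Walk G u y) →
    NonBacktracking (p ʳ++ʷ q) → NonBacktracking p × NonBacktracking q
  ʳ++ʷ-nonBacktracking⁻ p q nb with Linked-ʳ++⁻ (edgesOf G p) (subst (Linked _≢_) (edgesOf-ʳ++ʷ p q) nb)
  ... | nbp , _ , nbq = Linked.map ≢-sym nbp , nbq

  simplePath⇒nonBacktracking : (p : Walk G x y) → SimplePath G p → NonBacktracking p
  simplePath⇒nonBacktracking []          _          = []
  simplePath⇒nonBacktracking (s ∷ [])    _          = [-]
  simplePath⇒nonBacktracking (s ∷ t ∷ p) (x∉ ∷ sp) =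
    (λ eq → All¬⇒¬Any x∉ (there (subst (_∈ verts G p) (sameEdge-return s t eq) (head∈verts p))))
    ∷ simplePath⇒nonBacktracking (t ∷ p) sp

  simplePath⇒unique-edges : (p : Walk G x y) → SimplePath G p → Unique (edgesOf G p)
  simplePath⇒unique-edges []      _          = []
  simplePath⇒unique-edges (s ∷ p) (x∉ ∷ sp) =
    ¬Any⇒All¬ _ (λ e∈ → All¬⇒¬Any x∉ (endpoint∈verts p e∈ (stepEdge-source s)))
    ∷ simplePath⇒unique-edges p sp

  ∷-nonBacktracking : (s : Step G x y) (p : Walk G y z) → NonBacktracking p → Σ (Walk G x z) NonBacktracking
  ∷-nonBacktracking s []      _  = s ∷ [] , [-]
  ∷-nonBacktracking {z = z} s (t ∷ p) nb with stepEdge G s ≟ stepEdge G t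
  ... | yes eq = subst (λ w → Σ (Walk G w z) NonBacktracking) (sameEdge-return s t eq) (p , Linked.tail nb)
  ... | no  ne = s ∷ t ∷ p , ne ∷ nb

  reduce : Walk G x y → Σ (Walk G x y) NonBacktracking
  reduce []      = [] , []
  reduce (s ∷ p) with reduce p
  ... | p′ , nb = ∷-nonBacktracking s p′ nb

  segment : (p : Walk G y z) → x ∈ verts G p → Walk G y x
  segment []      (here refl) = []
  segment (_ ∷ _) (here refl) = []
  segment (s ∷ p) (there x∈)  = s ∷ segment p x∈

  segment-verts : ∀ {v} (p : Walk G y z) (x∈ : x ∈ verts G p) →
                  v ∈ verts G (segment p x∈) → v ∈ verts G p
  segment-verts []      (here refl) v∈          = v∈
  segment-verts (_ ∷ _) (here refl) (here v≡x)  = here v≡x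
  segment-verts (s ∷ p) (there x∈)  (here v≡y)  = here v≡y
  segment-verts (s ∷ p) (there x∈)  (there v∈)  = there (segment-verts p x∈ v∈)

  segment-simplePath : (p : Walk G y z) (x∈ : x ∈ verts G p) →
                       SimplePath G p → SimplePath G (segment p x∈)
  segment-simplePath []      (here refl) _          = [] ∷ []
  segment-simplePath (_ ∷ _) (here refl) _          = [] ∷ []
  segment-simplePath (s ∷ p) (there x∈)  (y∉ ∷ sp) =
    All.tabulate (λ v∈ → All.lookup y∉ (segment-verts p x∈ v∈)) ∷ segment-simplePath p x∈ sp

  stepEdge∉segment : (s : Step G x y) (p : Walk G y z) (x∈ : x ∈ verts G p) →
    NonBacktracking (s ∷ p) → SimplePath G p → stepEdge G s ∉ edgesOf G (segment p x∈)
  stepEdge∉segment s []      (here refl) _          _         ()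
  stepEdge∉segment s (_ ∷ _) (here refl) _          _         ()
  stepEdge∉segment s (t ∷ p) (there x∈) (s≢t ∷ _) _         (here eq)  = s≢t eq
  stepEdge∉segment s (t ∷ p) (there x∈) _          (y∉ ∷ _) (there e∈) =
    All¬⇒¬Any y∉ (segment-verts p x∈ (endpoint∈verts (segment p x∈) e∈ (stepEdge-target s)))

  nonBacktracking⇒simplePath : Acyclic G → (p : Walk G x y) → NonBacktracking p → SimplePath G p
  nonBacktracking⇒simplePath ac []              _  = [] ∷ []
  nonBacktracking⇒simplePath {x = x} ac (s ∷ p) nb = ¬Any⇒All¬ _ closes-cycle ∷ sp
    where
    sp = nonBacktracking⇒simplePath ac p (Linked.tail nb)
    closes-cycle : x ∉ verts G p
    closes-cycle x∈ = ac x (s ∷ segment p x∈)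
      ( s≤s z≤n
      , ¬Any⇒All¬ _ (stepEdge∉segment s p x∈ nb sp)
        ∷ simplePath⇒unique-edges (segment p x∈) (segment-simplePath p x∈ sp)
      , Unique-∷ʳ⇒∷ (innerVerts G (segment p x∈)) (segment-simplePath p x∈ sp))

  diverge-from-either : ∀ {c d : Fin k} {wx wy} → c ≢ d →
    (X : Walk G u x) (Y : Walk G u y) (Z : Walk G u z) → word G X ≡ c ∷ wx → word G Y ≡ d ∷ wy →
    Diverge X Z ⊎ (Diverge Y Z × ∃[ w ] word G Z ≡ c ∷ w)
  diverge-from-either c≢d (t ∷ X) (t′ ∷ Y) []      eqX eqY = inj₁ just-nothing
  diverge-from-either c≢d (t ∷ X) (t′ ∷ Y) (s ∷ Z) eqX eqY with stepEdge G t ≟ stepEdge G s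
  ... | no  t≢s = inj₁ (just t≢s)
  ... | yes t≡s =
    inj₂ ( just (λ t′≡s → c≢d (trans (sym labX) (trans (cong lab (trans t≡s (sym t′≡s))) labY)))
         , word G Z , cong (_∷ word G Z) (trans (cong lab (sym t≡s)) labX))
    where
    labX = ∷-injectiveˡ eqX
    labY = ∷-injectiveˡ eqY

  -- Z, read backwards, is continued by X unless Z leaves u along X's first edge;
  -- then it is continued by Y and the c is read off that first edge of Z, so S
  -- must fit into the rest of Z (hence the hypothesis on head S).
  continue-by-arm : ∀ {c d : Fin k} {S wx wy} → c ≢ d → head S ≢ just c →
    (X : Walk G u x) (Y : Walk G u y) (Z : Walk G u z) →
    NonBacktracking X → NonBacktracking Y → NonBacktracking Z →
    word G X ≡ c ∷ wx → d ∈ wx → word G Y ≡ d ∷ wy → S ⊆ word G Z →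
    ∃[ v ] Σ (Walk G z v) λ W → NonBacktracking W × S ʳ++ c ∷ d ∷ [] ⊆ word G W
  continue-by-arm {c = c} {d} {S} c≢d S≢c X Y Z nbX nbY nbZ eqX d∈ eqY σ
    with diverge-from-either c≢d X Y Z eqX eqY
  ... | inj₁ div =
    _ , Z ʳ++ʷ X , ʳ++ʷ-nonBacktracking Z X nbZ nbX (Diverge-sym div) ,
    subst (S ʳ++ c ∷ d ∷ [] ⊆_) (sym (trans (word-ʳ++ʷ Z X) (cong (word G Z ʳ++_) eqX)))
      (ʳ++⁺ σ (refl ∷ from∈ d∈))
  ... | inj₂ (div , w , eqZ) =
    _ , Z ʳ++ʷ Y , ʳ++ʷ-nonBacktracking Z Y nbZ nbY (Diverge-sym div) ,
    subst (S ʳ++ c ∷ d ∷ [] ⊆_) (sym (trans (word-ʳ++ʷ Z Y) (cong₂ _ʳ++_ eqZ eqY)))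
      (ʳ++⁺ (⊆-∷⁻ S≢c (subst (S ⊆_) eqZ σ)) (refl ∷ refl ∷ minimum _))

  split-nonBacktracking : (p : Walk G x y) → NonBacktracking p →
    ∀ u {c : Fin k} {w} → word G p ≡ u ++ c ∷ w →
    ∃[ v ] Σ (Walk G v x) λ p₁ → Σ (Walk G v y) λ p₂ →
      NonBacktracking p₁ × NonBacktracking p₂ × word G p₁ ≡ c ∷ reverse u × word G p₂ ≡ w
  split-nonBacktracking p nb u {c} {w} eq
    with splitʷ [] p (u ++ c ∷ []) (trans eq (sym (++-assoc u (c ∷ []) w)))
  ... | _ , p₁ , p₂ , refl , eq₁ , eq₂ with ʳ++ʷ-nonBacktracking⁻ p₁ p₂ nb
  ... | nb₁ , nb₂ = _ , p₁ , p₂ , nb₁ , nb₂ , trans eq₁ (++-ʳ++ u) , eq₂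

  alternating-walk : Connected G → ∀ {a b : Fin k} → a ≢ b →
    ∀ {x y} (p : Walk G x y) → NonBacktracking p →
      ∀ u {v} → word G p ≡ u ++ b ∷ a ∷ v → a ∈ u →
    ∀ {x′ y′} (q : Walk G x′ y′) → NonBacktracking q →
      ∀ u′ {v′} → word G q ≡ u′ ++ b ∷ a ∷ v′ → b ∈ v′ →
    ∃[ s ] ∃[ t ] Σ (Walk G s t) λ W → NonBacktracking W × a ∷ b ∷ a ∷ b ∷ [] ⊆ word G W
  alternating-walk conn a≢b p nbp u eqp a∈u q nbq u′ eqq b∈v′
    with split-nonBacktracking p nbp u eqp | split-nonBacktracking q nbq u′ eqq
  ... | vp , Pb , Pa , nbPb , nbPa , eqPb , eqPa | vq , Qb , Qa , nbQb , nbQa , eqQb , eqQa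
    with reduce (conn vp vq)
  ... | R , nbR
    with continue-by-arm (≢-sym a≢b) (λ ()) Pb Pa R nbPb nbPa nbR eqPb (reverse⁺ a∈u) eqPa (minimum _)
  ... | _ , W₁ , nbW₁ , σ₁
    with continue-by-arm a≢b (λ { refl → a≢b refl }) Qa Qb W₁ nbQa nbQb nbW₁ eqQa b∈v′ eqQb σ₁
  ... | _ , W , nbW , σ = _ , _ , W , nbW , σ

open Walks

lemma4 : ∀ {k' : ℕ} (T : LGraph (suc (suc k'))) → InT3 T →
    ¬ ((∃ λ (w : List (Fin (suc (suc k')))) → InL T w × InABA zero (suc zero) w)
    × (∃ λ (w : List (Fin (suc (suc k')))) → InL T w × InABA (suc zero) zero w))
lemma4 T (tree , blocks≤3)
  ((_ , (_ , _ , P , simpleP , refl) , abaP) , (_ , (_ , _ , Q , simpleQ , refl) , babQ)) =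
  let open IsTree tree
      (u , _ , eqP , 0∈u) = InABA-last-descent abaP
      (u′ , _ , eqQ , 1∈v′) = InABA-first-descent babQ
      (_ , _ , W , nbW , 0101⊆W) =
        alternating-walk T connected (λ ())
          P (simplePath⇒nonBacktracking T P simpleP) u eqP 0∈u
          Q (simplePath⇒nonBacktracking T Q simpleQ) u′ eqQ 1∈v′
      W∈L = _ , _ , W , nonBacktracking⇒simplePath T acyclic W nbW , refl
  in n≮n 3 (≤-trans (blocks-mono 0101⊆W) (blocks≤3 _ W∈L))
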